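{- Let $q$ be a power of an odd prime with $q\equiv 1\pmod 3$, let $R$ be the graph defined below over $\mathbb F_q$, let $\phi$ be an automorphism of $R$, and let $r,w\in\mathbb F_q$. If $\phi([0,1,r])=[0,1,w]$, then $\phi([0,0,r-1])=[0,0,w-1]$.
   Context: $R$ is the bipartite graph whose parts are the set of points $(p_1,p_2,p_3)\in\mathbb F_q^3$ and the set of lines $[l_1,l_2,l_3]\in\mathbb F_q^3$ (two disjoint copies of $\mathbb F_q^3$), where $(p_1,p_2,p_3)$ is adjacent to $[l_1,l_2,l_3]$ if and only if $p_2+l_2 = p_1l_1$ and $p_3+l_3 = p_1p_2l_1(p_1+p_2+p_1p_2)$. -}

module Defs where

open import Level using (0ℓ)
open import Data.Nat as ℕ using (ℕ)
open import Data.Fin using (Fin)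
open import Data.Product using (_×_; _,_; ∃-syntax)
open import Data.Empty using (⊥)
open import Relation.Nullary using (¬_)
open import Relation.Binary.PropositionalEquality using (_≡_)
open import Algebra.Structures using (IsCommutativeRing)
open import Function.Bundles using (_↔_; _⇔_; Inverse)

record FiniteField : Set₁ where
  infixl 6 _+_
  infixl 7 _*_
  infix  8 -_
  field
    F                 : Set
    _+_ _*_           : F → F → F
    -_                : F → F
    0# 1#             : F
    isCommutativeRing : IsCommutativeRing _≡_ _+_ _*_ -_ 0# 1#
    0≢1               : ¬ (0# ≡ 1#)
    inverse           : ∀ x → ¬ (x ≡ 0#) → ∃[ y ] (x * y ≡ 1#)
    card              : ℕ
    enum              : F ↔ Fin card

  _-_ : F → F → F
  x - y = x + (- y)

module GraphR (K : FiniteField) where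
  open FiniteField K

  -- vertices: points (p₁,p₂,p₃) and lines [l₁,l₂,l₃], two disjoint copies of F³
  data Vertex : Set where
    pt : F × F × F → Vertex
    ln : F × F × F → Vertex

  Inc : F × F × F → F × F × F → Set
  Inc (p₁ , p₂ , p₃) (l₁ , l₂ , l₃) =
    (p₂ + l₂ ≡ p₁ * l₁) ×
    (p₃ + l₃ ≡ p₁ * p₂ * l₁ * (p₁ + p₂ + p₁ * p₂))

  Adj : Vertex → Vertex → Set
  Adj (pt p) (ln l) = Inc p l
  Adj (ln l) (pt p) = Inc p l
  Adj (pt _) (pt _) = ⊥
  Adj (ln _) (ln _) = ⊥

  record Automorphism : Set where
    field
      φ        : Vertex ↔ Vertex
      preserve : ∀ u v → Adj u v ⇔ Adj (Inverse.to φ u) (Inverse.to φ v)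

  apply : Automorphism → Vertex → Vertex
  apply a = Inverse.to (Automorphism.φ a)

{-# OPTIONS --safe #-}
module Submission where

-- Call M a shadow of L when M and L have no common neighbour but some neighbour x of M has
-- all its other neighbours sharing a neighbour with L; shadows, and chains L → M → N of
-- shadows, are defined by adjacency alone, so automorphisms preserve them.
-- [0,1,r] → [0,0,r-1] → [0,1,r-1] is such a chain. Conversely, let M be a shadow of the
-- vertical line [0,c,v] through the point x. Then M is the vertical line through x, and every
-- line through x of slope a ≠ 0 meets [0,c,v]; eliminating the meeting point makes a a root
-- of a quadratic whose constant term is c(1-c)(x₂+c)². With q - 1 ≥ 3 slopes the quadratic
-- vanishes, which forces c ∈ {0,1}. In a chain [0,1,w] → M → N this makes M = [0,-x₂,-x₃]
-- with x₃ + w = x₂ + 1 and -x₂ ∈ {0,1}; as x is not on [0,1,w], -x₂ = 0 and M = [0,0,w-1].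

open import Defs
open import Level using (0ℓ)
open import Algebra.Bundles using (CommutativeRing)
open import Algebra.Solver.Ring.AlmostCommutativeRing
  using (fromCommutativeRing; _-Raw-AlmostCommutative⟶_)
open import Data.Empty using (⊥-elim)
open import Data.Fin.Base using (Fin; zero; suc; punchIn; inject≤)
open import Data.Fin.Properties using (punchIn-injective; punchInᵢ≢i; inject≤-injective; inj⇒≟)
open import Data.Integer.Base as ℤ using (ℤ; -[1+_]; _⊖_; _◃_; sign; ∣_∣)
import Data.Integer.Properties as ℤ
open import Data.Maybe.Base using (Maybe; just; nothing)
open import Data.Nat.Base as ℕ using (zero; suc; _%_; _^_; _≥_; s≤s)
import Data.Nat.Properties as ℕ
open import Data.Nat.Primality using (Prime; ¬prime[1])
open import Data.Product.Base using (_×_; _,_; ∃-syntax; Σ-syntax; proj₁; proj₂)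
open import Data.Product.Properties using (≡-dec)
open import Data.Sign.Base as Sign using (Sign)
open import Data.Sum.Base using (_⊎_; inj₁; inj₂; [_,_]′)
open import Function.Base using (_∘_; id)
open import Function.Bundles using (_↔_; _⇔_; Inverse; Equivalence; mk⇔; Injection)
open import Function.Definitions using (Injective)
open import Function.Properties.Inverse using (↔⇒↣; ↔-sym)
open import Relation.Binary.Definitions using (DecidableEquality)
import Relation.Binary.PropositionalEquality as ≡
open import Relation.Nullary using (¬_; yes; no)
open import Relation.Nullary.Decidable using (decidable-stable)

-- The reflective solver of the standard library takes its coefficients from the ring
-- itself, where 1# + - 1# is not recognisably zero; coefficients in ℤ are.
module ℤ-CoefficientSolver {c ℓ} (R : CommutativeRing c ℓ) where
  open CommutativeRing R
  open import Algebra.Properties.Ring ring using (-1*x≈-x; -‿distribʳ-*; -‿+-comm; -‿involutive; -0#≈0#)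
  open import Algebra.Properties.Semiring.Mult.TCOptimised semiring using (1+×; ×-homo-+; ×1-homo-*)
    renaming (_×_ to _×′_)
  open import Algebra.Properties.CommutativeSemigroup *-commutativeSemigroup using ()
    renaming (interchange to *-interchange)
  open import Algebra.Properties.CommutativeSemigroup +-commutativeSemigroup using ()
    renaming (interchange to +-interchange)
  open import Relation.Binary.Reasoning.Setoid setoid

  -- With the TCOptimised multiplication, fromℤ 1 and fromℤ 2 are 1# and 1# + 1# on the nose.
  fromℤ : ℤ → Carrier
  fromℤ (ℤ.+ n)    = n ×′ 1#
  fromℤ (-[1+ n ]) = - (suc n ×′ 1#)

  signed : Sign → Carrier
  signed Sign.+ = 1#
  signed Sign.- = - 1#

  signed-homo : ∀ s t → signed (s Sign.* t) ≈ signed s * signed t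
  signed-homo Sign.+ t      = sym (*-identityˡ _)
  signed-homo Sign.- Sign.+ = sym (*-identityʳ _)
  signed-homo Sign.- Sign.- = begin
    1#               ≈⟨ -‿involutive 1# ⟨
    - - 1#           ≈⟨ -‿cong (-1*x≈-x 1#) ⟨
    - (- 1# * 1#)    ≈⟨ -‿distribʳ-* (- 1#) 1# ⟩
    - 1# * - 1#      ∎

  ◃-homo : ∀ s n → fromℤ (s ◃ n) ≈ signed s * (n ×′ 1#)
  ◃-homo Sign.+ zero    = sym (*-identityˡ _)
  ◃-homo Sign.- zero    = sym (zeroʳ _)
  ◃-homo Sign.+ (suc n) = sym (*-identityˡ _)
  ◃-homo Sign.- (suc n) = sym (-1*x≈-x _)

  fromℤ-signAbs : ∀ i → fromℤ i ≈ signed (sign i) * (∣ i ∣ ×′ 1#)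
  fromℤ-signAbs i = begin
    fromℤ i                          ≡⟨ ≡.cong fromℤ (ℤ.◃-inverse i) ⟨
    fromℤ (sign i ◃ ∣ i ∣)           ≈⟨ ◃-homo (sign i) ∣ i ∣ ⟩
    signed (sign i) * (∣ i ∣ ×′ 1#)  ∎

  *-homo : ∀ i j → fromℤ (i ℤ.* j) ≈ fromℤ i * fromℤ j
  *-homo i j = begin
    fromℤ (sign i Sign.* sign j ◃ ∣ i ∣ ℕ.* ∣ j ∣)
      ≈⟨ ◃-homo (sign i Sign.* sign j) (∣ i ∣ ℕ.* ∣ j ∣) ⟩
    signed (sign i Sign.* sign j) * ((∣ i ∣ ℕ.* ∣ j ∣) ×′ 1#)
      ≈⟨ *-cong (signed-homo (sign i) (sign j)) (×1-homo-* ∣ i ∣ ∣ j ∣) ⟩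
    (signed (sign i) * signed (sign j)) * ((∣ i ∣ ×′ 1#) * (∣ j ∣ ×′ 1#))
      ≈⟨ *-interchange _ _ _ _ ⟩
    (signed (sign i) * (∣ i ∣ ×′ 1#)) * (signed (sign j) * (∣ j ∣ ×′ 1#))
      ≈⟨ *-cong (fromℤ-signAbs i) (fromℤ-signAbs j) ⟨
    fromℤ i * fromℤ j
      ∎

  ⊖-homo : ∀ m n → fromℤ (m ⊖ n) ≈ m ×′ 1# - n ×′ 1#
  ⊖-homo m       zero    = sym (trans (+-congˡ -0#≈0#) (+-identityʳ _))
  ⊖-homo zero    (suc n) = sym (+-identityˡ _)
  ⊖-homo (suc m) (suc n) = begin
    fromℤ (suc m ⊖ suc n)              ≡⟨ ≡.cong fromℤ (ℤ.[1+m]⊖[1+n]≡m⊖n m n) ⟩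
    fromℤ (m ⊖ n)                      ≈⟨ ⊖-homo m n ⟩
    m ×′ 1# - n ×′ 1#                  ≈⟨ cancel-1# (m ×′ 1#) (n ×′ 1#) ⟨
    (1# + m ×′ 1#) - (1# + n ×′ 1#)    ≈⟨ +-cong (1+× m 1#) (-‿cong (1+× n 1#)) ⟨
    suc m ×′ 1# - suc n ×′ 1#          ∎
    where
    cancel-1# : ∀ a b → (1# + a) - (1# + b) ≈ a - b
    cancel-1# a b = begin
      (1# + a) - (1# + b)       ≈⟨ +-congˡ (-‿+-comm 1# b) ⟨
      (1# + a) + (- 1# - b)     ≈⟨ +-interchange 1# a (- 1#) (- b) ⟩
      (1# - 1#) + (a - b)       ≈⟨ +-congʳ (-‿inverseʳ 1#) ⟩
      0# + (a - b)              ≈⟨ +-identityˡ (a - b) ⟩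
      a - b                     ∎

  +-homo : ∀ i j → fromℤ (i ℤ.+ j) ≈ fromℤ i + fromℤ j
  +-homo (ℤ.+ m)   (ℤ.+ n)   = ×-homo-+ 1# m n
  +-homo (ℤ.+ m)   -[1+ n ]  = ⊖-homo m (suc n)
  +-homo -[1+ m ]  (ℤ.+ n)   = trans (⊖-homo n (suc m)) (+-comm _ _)
  +-homo -[1+ m ] -[1+ n ] = begin
    - (suc (suc (m ℕ.+ n)) ×′ 1#)       ≡⟨ ≡.cong (λ k → - (suc k ×′ 1#)) (ℕ.+-suc m n) ⟨
    - ((suc m ℕ.+ suc n) ×′ 1#)         ≈⟨ -‿cong (×-homo-+ 1# (suc m) (suc n)) ⟩
    - (suc m ×′ 1# + suc n ×′ 1#)       ≈⟨ -‿+-comm _ _ ⟨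
    - (suc m ×′ 1#) + - (suc n ×′ 1#)   ∎

  -‿homo : ∀ i → fromℤ (ℤ.- i) ≈ - fromℤ i
  -‿homo (ℤ.+ zero)  = sym -0#≈0#
  -‿homo (ℤ.+ suc n) = refl
  -‿homo -[1+ n ]    = sym (-‿involutive _)

  morphism : ℤ.+-*-rawRing -Raw-AlmostCommutative⟶ fromCommutativeRing R
  morphism = record
    { ⟦_⟧ = fromℤ ; +-homo = +-homo ; *-homo = *-homo ; -‿homo = -‿homo
    ; 0-homo = refl ; 1-homo = refl }

  fromℤ-≟ : ∀ i j → Maybe (fromℤ i ≈ fromℤ j)
  fromℤ-≟ i j with i ℤ.≟ j
  ... | yes ≡.refl = just refl
  ... | no _       = nothing

  open import Algebra.Solver.Ring ℤ.+-*-rawRing (fromCommutativeRing R) morphism fromℤ-≟ public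
    using (Polynomial; solve; _:=_; _:+_; _:-_; _:*_; :-_; con)

  :0 :1 :2 : ∀ {n} → Polynomial n
  :0 = con (ℤ.+ 0)
  :1 = con (ℤ.+ 1)
  :2 = con (ℤ.+ 2)

open ≡ using (_≡_; _≢_; refl; sym; trans; cong; cong₂; subst; subst₂; module ≡-Reasoning)
open ≡-Reasoning

three-distinct-avoiding : ∀ {A : Set} {n} → A ↔ Fin n → 4 ℕ.≤ n → (z : A) →
                 Σ[ h ∈ (Fin 3 → A) ] (Injective _≡_ _≡_ h × (∀ i → h i ≢ z))
three-distinct-avoiding e (s≤s 3≤n) z = h , h-injective , h≢z
  where
  open Inverse e using (to; from; strictlyInverseˡ)
  h : Fin 3 → _
  h i = from (punchIn (to z) (inject≤ i 3≤n))
  h-injective : Injective _≡_ _≡_ h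
  h-injective = inject≤-injective 3≤n 3≤n _ _ ∘ punchIn-injective (to z) _ _
              ∘ Injection.injective (↔⇒↣ (↔-sym e))
  h≢z : ∀ i → h i ≢ z
  h≢z i hi≡z = punchInᵢ≢i (to z) (inject≤ i 3≤n)
    (trans (sym (strictlyInverseˡ _)) (cong to hi≡z))

module FieldFacts (K : FiniteField) where
  open FiniteField K

  commutativeRing : CommutativeRing 0ℓ 0ℓ
  commutativeRing = record { isCommutativeRing = isCommutativeRing }

  open CommutativeRing commutativeRing public
    using (+-identityˡ; +-identityʳ; *-identityˡ; zeroˡ; zeroʳ; *-comm; -‿inverseˡ; -‿inverseʳ)
  open import Algebra.Properties.Ring (CommutativeRing.ring commutativeRing) public
    using (-‿involutive; +-inverseˡ-unique; +-inverseʳ-unique; x∙y⁻¹≈ε⇒x≈y)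
  open ℤ-CoefficientSolver commutativeRing public
    using (solve; _:=_; _:+_; _:-_; _:*_; :-_; :0; :1; :2)

  _≟_ : DecidableEquality F
  _≟_ = inj⇒≟ (↔⇒↣ enum)

  zero-product : ∀ {a b} → a * b ≡ 0# → a ≡ 0# ⊎ b ≡ 0#
  zero-product {a} {b} ab≡0 with a ≟ 0# | inverse a
  ... | yes a≡0 | _   = inj₁ a≡0
  ... | no a≢0  | inv with inv a≢0
  ...   | a⁻¹ , aa⁻¹≡1 = inj₂ (begin
    b                ≡⟨ sym (*-identityˡ b) ⟩
    1# * b           ≡⟨ cong (_* b) aa⁻¹≡1 ⟨
    (a * a⁻¹) * b    ≡⟨ solve 3 (λ a a⁻¹ b → (a :* a⁻¹) :* b := a⁻¹ :* (a :* b)) refl a a⁻¹ b ⟩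
    a⁻¹ * (a * b)    ≡⟨ cong (a⁻¹ *_) ab≡0 ⟩
    a⁻¹ * 0#         ≡⟨ zeroʳ a⁻¹ ⟩
    0#               ∎)

  nonzero*x≡0⇒x≡0 : ∀ {a b} → a ≢ 0# → a * b ≡ 0# → b ≡ 0#
  nonzero*x≡0⇒x≡0 a≢0 = [ ⊥-elim ∘ a≢0 , id ]′ ∘ zero-product

  x*nonzero≡0⇒x≡0 : ∀ {a b} → b ≢ 0# → a * b ≡ 0# → a ≡ 0#
  x*nonzero≡0⇒x≡0 b≢0 = [ id , ⊥-elim ∘ b≢0 ]′ ∘ zero-product

  quadratic-three-roots : ∀ {α β γ a b c} → a ≢ b → a ≢ c → b ≢ c →
    α * (a * a) + β * a + γ ≡ 0# → α * (b * b) + β * b + γ ≡ 0# → α * (c * c) + β * c + γ ≡ 0# →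
    α ≡ 0# × β ≡ 0# × γ ≡ 0#
  quadratic-three-roots {α} {β} {γ} {a} {b} {c} a≢b a≢c b≢c qa qb qc = α≡0 , β≡0 , γ≡0
    where
    secant : ∀ {x y} → x ≢ y → α * (x * x) + β * x + γ ≡ 0# → α * (y * y) + β * y + γ ≡ 0# →
             α * (x + y) + β ≡ 0#
    secant {x} {y} x≢y qx qy = nonzero*x≡0⇒x≡0 (x≢y ∘ x∙y⁻¹≈ε⇒x≈y x y) (begin
      (x + - y) * (α * (x + y) + β)
        ≡⟨ solve 5 (λ α β γ x y →
               (x :- y) :* (α :* (x :+ y) :+ β)
                 := (α :* (x :* x) :+ β :* x :+ γ) :- (α :* (y :* y) :+ β :* y :+ γ))
             refl α β γ x y ⟩
      (α * (x * x) + β * x + γ) + - (α * (y * y) + β * y + γ)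
        ≡⟨ cong₂ (λ u w → u + - w) qx qy ⟩
      0# + - 0#
        ≡⟨ -‿inverseʳ 0# ⟩
      0# ∎)
    α≡0 : α ≡ 0#
    α≡0 = nonzero*x≡0⇒x≡0 (b≢c ∘ x∙y⁻¹≈ε⇒x≈y b c) (begin
      (b + - c) * α
        ≡⟨ solve 5 (λ α β a b c → (b :- c) :* α := (α :* (a :+ b) :+ β) :- (α :* (a :+ c) :+ β))
             refl α β a b c ⟩
      (α * (a + b) + β) + - (α * (a + c) + β)
        ≡⟨ cong₂ (λ u w → u + - w) (secant a≢b qa qb) (secant a≢c qa qc) ⟩
      0# + - 0#
        ≡⟨ -‿inverseʳ 0# ⟩
      0# ∎)
    β≡0 : β ≡ 0#
    β≡0 = begin
      β                  ≡⟨ solve 3 (λ β a b → β := :0 :* (a :+ b) :+ β) refl β a b ⟩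
      0# * (a + b) + β   ≡⟨ cong (λ u → u * (a + b) + β) α≡0 ⟨
      α * (a + b) + β    ≡⟨ secant a≢b qa qb ⟩
      0#                 ∎
    γ≡0 : γ ≡ 0#
    γ≡0 = begin
      γ                              ≡⟨ solve 2 (λ γ a → γ := :0 :* (a :* a) :+ :0 :* a :+ γ) refl γ a ⟩
      0# * (a * a) + 0# * a + γ      ≡⟨ cong₂ (λ u w → u * (a * a) + w * a + γ) α≡0 β≡0 ⟨
      α * (a * a) + β * a + γ        ≡⟨ qa ⟩
      0#                             ∎

  quadratic-vanishing-on-units : 4 ℕ.≤ card → ∀ {α β γ} →
    (∀ a → a ≢ 0# → α * (a * a) + β * a + γ ≡ 0#) → α ≡ 0# × β ≡ 0# × γ ≡ 0#
  quadratic-vanishing-on-units 4≤q vanishes with three-distinct-avoiding enum 4≤q 0#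
  ... | h , h-injective , h≢0 = quadratic-three-roots
    (distinct λ ()) (distinct λ ()) (distinct λ ())
    (vanishes _ (h≢0 zero)) (vanishes _ (h≢0 (suc zero))) (vanishes _ (h≢0 (suc (suc zero))))
    where
    distinct : ∀ {i j} → i ≢ j → h i ≢ h j
    distinct i≢j = i≢j ∘ h-injective

module Geometry (K : FiniteField) where
  open FiniteField K
  open GraphR K
  open FieldFacts K

  Point Line : Set
  Point = F × F × F
  Line  = F × F × F

  ln-injective : ∀ {l m} → ln l ≡ ln m → l ≡ m
  ln-injective refl = refl

  pt-injective : ∀ {p q} → pt p ≡ pt q → p ≡ q
  pt-injective refl = refl

  ln-stable : ∀ {l m} → ¬ ¬ (ln l ≡ ln m) → ln l ≡ ln m
  ln-stable {l} {m} ¬¬l≡m =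
    cong ln (decidable-stable (≡-dec _≟_ (≡-dec _≟_ _≟_) l m) (λ l≢m → ¬¬l≡m (l≢m ∘ ln-injective)))

  lineThrough : Point → F → Line
  lineThrough (x₁ , x₂ , x₃) a = a , x₁ * a + - x₂ , x₁ * x₂ * a * (x₁ + x₂ + x₁ * x₂) + - x₃

  pointOn : Line → F → Point
  pointOn (l₁ , l₂ , l₃) t =
    t , t * l₁ + - l₂ , t * (t * l₁ + - l₂) * l₁ * (t + (t * l₁ + - l₂) + t * (t * l₁ + - l₂)) + - l₃

  lineThrough-inc : ∀ x a → Inc x (lineThrough x a)
  lineThrough-inc (x₁ , x₂ , x₃) a = cancel x₂ _ , cancel x₃ _
    where
    cancel : ∀ u w → u + (w + - u) ≡ w
    cancel = solve 2 (λ u w → u :+ (w :- u) := w) refl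

  pointOn-inc : ∀ l t → Inc (pointOn l t) l
  pointOn-inc (l₁ , l₂ , l₃) t = cancel _ l₂ , cancel _ l₃
    where
    cancel : ∀ w u → (w + - u) + u ≡ w
    cancel = solve 2 (λ w u → (w :- u) :+ u := w) refl

  inc-vertical : ∀ {p₁ p₂ p₃ c v} → Inc (p₁ , p₂ , p₃) (0# , c , v) ⇔ (p₂ + c ≡ 0# × p₃ + v ≡ 0#)
  inc-vertical {p₁} {p₂} {p₃} = mk⇔
    (λ (e₂ , e₃) → trans e₂ vanish₂ , trans e₃ vanish₃)
    (λ (e₂ , e₃) → trans e₂ (sym vanish₂) , trans e₃ (sym vanish₃))
    where
    vanish₂ : p₁ * 0# ≡ 0#
    vanish₂ = zeroʳ p₁
    vanish₃ : p₁ * p₂ * 0# * (p₁ + p₂ + p₁ * p₂) ≡ 0#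
    vanish₃ = trans (cong (_* (p₁ + p₂ + p₁ * p₂)) (zeroʳ (p₁ * p₂))) (zeroˡ _)

  inc-axis : ∀ {p₂ p₃ l₁ l₂ l₃} → Inc (0# , p₂ , p₃) (l₁ , l₂ , l₃) ⇔ (p₂ + l₂ ≡ 0# × p₃ + l₃ ≡ 0#)
  inc-axis {p₂} {p₃} {l₁} = mk⇔
    (λ (e₂ , e₃) → trans e₂ vanish₂ , trans e₃ vanish₃)
    (λ (e₂ , e₃) → trans e₂ (sym vanish₂) , trans e₃ (sym vanish₃))
    where
    vanish₂ : 0# * l₁ ≡ 0#
    vanish₂ = zeroˡ l₁
    vanish₃ : 0# * p₂ * l₁ * (0# + p₂ + 0# * p₂) ≡ 0#
    vanish₃ = trans (cong (λ u → u * l₁ * (0# + p₂ + 0# * p₂)) (zeroˡ p₂))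
                    (trans (cong (_* (0# + p₂ + 0# * p₂)) (zeroˡ l₁)) (zeroˡ _))

  adj-sym : ∀ {u v} → Adj u v → Adj v u
  adj-sym {pt _} {ln _} u~v = u~v
  adj-sym {ln _} {pt _} u~v = u~v

  CommonNeighbour : Vertex → Vertex → Set
  CommonNeighbour u v = ∃[ x ] (Adj x u × Adj x v)

  Shadow : Vertex → Vertex → Set
  Shadow L M = ¬ CommonNeighbour L M
             × ∃[ x ] (Adj x M × (∀ N → Adj x N → N ≢ M → CommonNeighbour L N))

  ShadowChain : Vertex → Vertex → Set
  ShadowChain L M = Shadow L M × ∃[ N ] Shadow M N

  line-point-apart : ∀ {l p} → ¬ CommonNeighbour (ln l) (pt p)
  line-point-apart (pt _ , _ , ())
  line-point-apart (ln _ , () , _)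

  vertical-common-neighbour : ∀ {c v c′ v′} →
    CommonNeighbour (ln (0# , c , v)) (ln (0# , c′ , v′)) → c ≡ c′ × v ≡ v′
  vertical-common-neighbour (ln _ , () , _)
  vertical-common-neighbour (pt _ , p∈L , p∈L′)
    with Equivalence.to inc-vertical p∈L | Equivalence.to inc-vertical p∈L′
  ... | e₂ , e₃ | e₂′ , e₃′ = trans (+-inverseʳ-unique _ _ e₂) (sym (+-inverseʳ-unique _ _ e₂′))
                            , trans (+-inverseʳ-unique _ _ e₃) (sym (+-inverseʳ-unique _ _ e₃′))

  module Preservation (σ : Automorphism) where
    open Inverse (Automorphism.φ σ) using (to; from; strictlyInverseˡ)

    adj⇒ : ∀ {u v} → Adj u v → Adj (to u) (to v)
    adj⇒ = Equivalence.to (Automorphism.preserve σ _ _)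

    adj⇐ : ∀ {u y} → Adj (to u) y → Adj u (from y)
    adj⇐ {u} {y} h =
      Equivalence.from (Automorphism.preserve σ _ _) (subst (Adj (to u)) (sym (strictlyInverseˡ y)) h)

    commonNeighbour⇒ : ∀ {u v} → CommonNeighbour u v → CommonNeighbour (to u) (to v)
    commonNeighbour⇒ (x , x~u , x~v) = to x , adj⇒ x~u , adj⇒ x~v

    commonNeighbour⇐ : ∀ {u v} → CommonNeighbour (to u) (to v) → CommonNeighbour u v
    commonNeighbour⇐ (y , y~u , y~v) =
      from y , adj-sym (adj⇐ (adj-sym y~u)) , adj-sym (adj⇐ (adj-sym y~v))

    shadow⇒ : ∀ {L M} → Shadow L M → Shadow (to L) (to M)
    shadow⇒ {L} {M} (apart , x , x~M , near) = apart ∘ commonNeighbour⇐ , to x , adj⇒ x~M , near′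
      where
      near′ : ∀ N → Adj (to x) N → N ≢ to M → CommonNeighbour (to L) N
      near′ N x~N N≢M = subst (CommonNeighbour (to L)) (strictlyInverseˡ N)
        (commonNeighbour⇒ (near (from N) (adj⇐ x~N)
          (λ e → N≢M (trans (sym (strictlyInverseˡ N)) (cong to e)))))

    shadowChain⇒ : ∀ {L M} → ShadowChain L M → ShadowChain (to L) (to M)
    shadowChain⇒ (s , N , s′) = shadow⇒ s , to N , shadow⇒ s′

  -- If the line through x of slope a meets [0,c,v] in (t, -c, -v), then t a = x₁ a - (x₂ + c);
  -- substituting this into a times the second incidence equation leaves a quadratic in a.
  leadingCoefficient linearCoefficient constantCoefficient : F → F → Point → F
  leadingCoefficient c v (x₁ , x₂ , x₃) =
    x₁ * x₂ * (x₁ + x₂ + x₁ * x₂) + c * (1# + - c) * x₁ * x₁ + - (c * c * x₁)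
  linearCoefficient c v (x₁ , x₂ , x₃) =
    (c * c + - ((1# + 1#) * c * (1# + - c) * x₁)) * (x₂ + c) + - (x₃ + v)
  constantCoefficient c v (x₁ , x₂ , x₃) =
    c * (1# + - c) * (x₂ + c) * (x₂ + c)

  meeting-slope-root : ∀ {c v} x a → CommonNeighbour (ln (0# , c , v)) (ln (lineThrough x a)) →
    leadingCoefficient c v x * (a * a) + linearCoefficient c v x * a + constantCoefficient c v x ≡ 0#
  meeting-slope-root _ _ (ln _ , () , _)
  meeting-slope-root {c} {v} (x₁ , x₂ , x₃) a (pt (t , p₂ , p₃) , p∈L , e₂ , e₃)
    with Equivalence.to inc-vertical p∈L
  ... | p₂+c≡0 , p₃+v≡0 = begin
    leadingCoefficient c v (x₁ , x₂ , x₃) * (a * a) + linearCoefficient c v (x₁ , x₂ , x₃) * a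
      + constantCoefficient c v (x₁ , x₂ , x₃)
      ≡⟨ solve 6 (λ c v x₁ x₂ x₃ a →
           (x₁ :* x₂ :* (x₁ :+ x₂ :+ x₁ :* x₂) :+ c :* (:1 :- c) :* x₁ :* x₁ :- c :* c :* x₁) :* (a :* a)
           :+ ((c :* c :- :2 :* c :* (:1 :- c) :* x₁) :* (x₂ :+ c) :- (x₃ :+ v)) :* a
           :+ c :* (:1 :- c) :* (x₂ :+ c) :* (x₂ :+ c)
           := a :* (:- v :+ (x₁ :* x₂ :* a :* (x₁ :+ x₂ :+ x₁ :* x₂) :- x₃))
              :+ c :* (:- c :+ (x₁ :* a :- x₂)) :* ((:1 :- c) :* (:- c :+ (x₁ :* a :- x₂)) :- c :* a))
           refl c v x₁ x₂ x₃ a ⟩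
    a * (- v + (x₁ * x₂ * a * (x₁ + x₂ + x₁ * x₂) + - x₃))
      + c * (- c + (x₁ * a + - x₂)) * ((1# + - c) * (- c + (x₁ * a + - x₂)) + - (c * a))
      ≡⟨ cong₂ (λ u w → a * u + c * w * ((1# + - c) * w + - (c * a))) e₃′ e₂′ ⟩
    a * (t * - c * a * (t + - c + t * - c)) + c * (t * a) * ((1# + - c) * (t * a) + - (c * a))
      ≡⟨ solve 3 (λ a c t → a :* (t :* :- c :* a :* (t :- c :+ t :* :- c))
                          :+ c :* (t :* a) :* ((:1 :- c) :* (t :* a) :- c :* a)
                          := :0) refl a c t ⟩
    0# ∎
    where
    p₂≡-c : p₂ ≡ - c
    p₂≡-c = +-inverseˡ-unique p₂ c p₂+c≡0
    p₃≡-v : p₃ ≡ - v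
    p₃≡-v = +-inverseˡ-unique p₃ v p₃+v≡0
    e₂′ : - c + (x₁ * a + - x₂) ≡ t * a
    e₂′ = subst (λ u → u + (x₁ * a + - x₂) ≡ t * a) p₂≡-c e₂
    e₃′ : - v + (x₁ * x₂ * a * (x₁ + x₂ + x₁ * x₂) + - x₃) ≡ t * - c * a * (t + - c + t * - c)
    e₃′ = subst₂ (λ u w → w + (x₁ * x₂ * a * (x₁ + x₂ + x₁ * x₂) + - x₃) ≡ t * u * a * (t + u + t * u))
                 p₂≡-c p₃≡-v e₃

  record VerticalShadow (c v : F) (Y : Vertex) : Set where
    field
      x₁ x₂ x₃          : F
      vertical          : Y ≡ ln (0# , - x₂ , - x₃)
      off-line          : ¬ (x₂ + c ≡ 0# × x₃ + v ≡ 0#)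
      linear-vanishes   : linearCoefficient c v (x₁ , x₂ , x₃) ≡ 0#
      constant-vanishes : constantCoefficient c v (x₁ , x₂ , x₃) ≡ 0#

    x₂+c≢0 : x₂ + c ≢ 0#
    x₂+c≢0 x₂+c≡0 = off-line
      (x₂+c≡0 , trans (sym (x∙y⁻¹≈ε⇒x≈y _ _ linear-vanishes))
                      (trans (cong ((c * c + - ((1# + 1#) * c * (1# + - c) * x₁)) *_) x₂+c≡0) (zeroʳ _)))

  shadow-of-vertical : 4 ℕ.≤ card → ∀ {c v Y} → Shadow (ln (0# , c , v)) Y → VerticalShadow c v Y
  shadow-of-vertical _ {Y = pt _} (_ , pt _ , () , _)
  shadow-of-vertical _ {Y = pt y} (_ , ln l , _ , near) =
    ⊥-elim (on-l 0# (λ e₀ → on-l 1# (λ e₁ → 0≢1 (cong proj₁ (pt-injective (trans e₀ (sym e₁)))))))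
    where
    on-l : ∀ t → ¬ ¬ (pt (pointOn l t) ≡ pt y)
    on-l t p≢y = line-point-apart (near _ (pointOn-inc l t) p≢y)
  shadow-of-vertical _ {Y = ln _} (_ , ln _ , () , _)
  shadow-of-vertical 4≤q {c} {v} {ln m} (apart , pt x@(x₁ , x₂ , x₃) , x∈Y , near) = record
    { x₁ = x₁ ; x₂ = x₂ ; x₃ = x₃
    ; vertical = Y-vertical
    ; off-line = off-line
    ; linear-vanishes = proj₁ (proj₂ coefficients-vanish)
    ; constant-vanishes = proj₂ (proj₂ coefficients-vanish)
    }
    where
    off-line : ¬ (x₂ + c ≡ 0# × x₃ + v ≡ 0#)
    off-line x∈L = apart (pt x , Equivalence.from inc-vertical x∈L , x∈Y)
    Y-vertical : ln m ≡ ln (0# , - x₂ , - x₃)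
    Y-vertical = sym (ln-stable λ V≢Y → off-line (through-x (vertical-common-neighbour
      (near _ (Equivalence.from inc-vertical (-‿inverseʳ x₂ , -‿inverseʳ x₃)) V≢Y))))
      where
      through-x : c ≡ - x₂ × v ≡ - x₃ → x₂ + c ≡ 0# × x₃ + v ≡ 0#
      through-x (c≡-x₂ , v≡-x₃) = trans (cong (x₂ +_) c≡-x₂) (-‿inverseʳ x₂)
                                , trans (cong (x₃ +_) v≡-x₃) (-‿inverseʳ x₃)
    coefficients-vanish : leadingCoefficient c v x ≡ 0# × linearCoefficient c v x ≡ 0#
                        × constantCoefficient c v x ≡ 0#
    coefficients-vanish = quadratic-vanishing-on-units 4≤q λ a a≢0 →
      meeting-slope-root x a (near _ (lineThrough-inc x a)
        (λ e → a≢0 (cong proj₁ (ln-injective (trans e Y-vertical)))))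

  vertical-with-shadow⇒c≡0⊎c≡1 : 4 ℕ.≤ card → ∀ {c v Y} → Shadow (ln (0# , c , v)) Y →
                                 c ≡ 0# ⊎ c ≡ 1#
  vertical-with-shadow⇒c≡0⊎c≡1 4≤q {c} s =
    [ inj₁ , inj₂ ∘ sym ∘ x∙y⁻¹≈ε⇒x≈y 1# c ]′
      (zero-product (x*nonzero≡0⇒x≡0 x₂+c≢0 (x*nonzero≡0⇒x≡0 x₂+c≢0 constant-vanishes)))
    where open VerticalShadow (shadow-of-vertical 4≤q s)

  shadowChain-[0,1,w]⇒[0,0,w-1] : 4 ℕ.≤ card → ∀ {w Y} → ShadowChain (ln (0# , 1# , w)) Y →
                                  Y ≡ ln (0# , 0# , w - 1#)
  shadowChain-[0,1,w]⇒[0,0,w-1] 4≤q {w} (s , N , s′) =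
    [ (λ -x₂≡0 → trans vertical (cong₂ (λ u z → ln (0# , u , z)) -x₂≡0 (-x₃≡w-1 -x₂≡0)))
    , (λ -x₂≡1 → ⊥-elim (x₂+c≢0 (trans (cong (x₂ +_) (sym -x₂≡1)) (-‿inverseʳ x₂))))
    ]′ (vertical-with-shadow⇒c≡0⊎c≡1 4≤q (subst (λ Y → Shadow Y N) vertical s′))
    where
    open VerticalShadow (shadow-of-vertical 4≤q s)
    -x₃≡w-1 : - x₂ ≡ 0# → - x₃ ≡ w + - 1#
    -x₃≡w-1 -x₂≡0 = begin
      - x₃
        ≡⟨ solve 4 (λ w x₁ x₂ x₃ → :- x₃
             := (w :- :1) :+ :- x₂
                :+ ((:1 :* :1 :- :2 :* :1 :* (:1 :- :1) :* x₁) :* (x₂ :+ :1) :- (x₃ :+ w)))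
             refl w x₁ x₂ x₃ ⟩
      (w + - 1#) + - x₂ + linearCoefficient 1# w (x₁ , x₂ , x₃)
        ≡⟨ cong₂ (λ u z → (w + - 1#) + u + z) -x₂≡0 linear-vanishes ⟩
      (w + - 1#) + 0# + 0#
        ≡⟨ solve 1 (λ w → (w :- :1) :+ :0 :+ :0 := w :- :1) refl w ⟩
      w + - 1# ∎

  vertical-shadow-criterion : ∀ {L c v} → ¬ CommonNeighbour L (ln (0# , c , v)) →
    (∀ a → a ≢ 0# → CommonNeighbour L (ln (a , c , v))) → Shadow L (ln (0# , c , v))
  vertical-shadow-criterion {L} {c} {v} apart meets =
    apart , pt (0# , - c , - v) , Equivalence.from inc-vertical (-‿inverseˡ c , -‿inverseˡ v) , near
    where
    near : ∀ N → Adj (pt (0# , - c , - v)) N → N ≢ ln (0# , c , v) → CommonNeighbour L N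
    near (ln (a , l₂ , l₃)) x∈N N≢M with Equivalence.to inc-axis x∈N
    ... | e₂ , e₃ with l₂≡c ← trans (+-inverseʳ-unique _ _ e₂) (-‿involutive c)
                   | l₃≡v ← trans (+-inverseʳ-unique _ _ e₃) (-‿involutive v)
                   | a ≟ 0#
    ...   | yes a≡0 = ⊥-elim (N≢M (cong ln (cong₂ _,_ a≡0 (cong₂ _,_ l₂≡c l₃≡v))))
    ...   | no a≢0  =
      subst (λ m → CommonNeighbour L (ln (a , m))) (sym (cong₂ _,_ l₂≡c l₃≡v)) (meets a a≢0)

  shadow-[0,1,r]→[0,0,r-1] : ∀ r → Shadow (ln (0# , 1# , r)) (ln (0# , 0# , r - 1#))
  shadow-[0,1,r]→[0,0,r-1] r =
    vertical-shadow-criterion (0≢1 ∘ sym ∘ proj₁ ∘ vertical-common-neighbour) meets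
    where
    meets : ∀ a → a ≢ 0# → CommonNeighbour (ln (0# , 1# , r)) (ln (a , 0# , r - 1#))
    meets a a≢0 with a⁻¹ , aa⁻¹≡1 ← inverse a a≢0 =
      pt (- a⁻¹ , - 1# , - r) , Equivalence.from inc-vertical (-‿inverseˡ 1# , -‿inverseˡ r) , e₂ , e₃
      where
      -1≡-aa⁻¹ : - 1# ≡ - (a * a⁻¹)
      -1≡-aa⁻¹ = cong -_ (sym aa⁻¹≡1)
      e₂ : - 1# + 0# ≡ - a⁻¹ * a
      e₂ = begin
        - 1# + 0#     ≡⟨ +-identityʳ _ ⟩
        - 1#          ≡⟨ -1≡-aa⁻¹ ⟩
        - (a * a⁻¹)   ≡⟨ solve 2 (λ a a⁻¹ → :- (a :* a⁻¹) := :- a⁻¹ :* a) refl a a⁻¹ ⟩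
        - a⁻¹ * a     ∎
      e₃ : - r + (r + - 1#) ≡ - a⁻¹ * - 1# * a * (- a⁻¹ + - 1# + - a⁻¹ * - 1#)
      e₃ = begin
        - r + (r + - 1#)
          ≡⟨ solve 1 (λ r → :- r :+ (r :- :1) := :- :1) refl r ⟩
        - 1#
          ≡⟨ -1≡-aa⁻¹ ⟩
        - (a * a⁻¹)
          ≡⟨ solve 2 (λ a a⁻¹ → :- (a :* a⁻¹)
               := :- a⁻¹ :* :- :1 :* a :* (:- a⁻¹ :- :1 :+ :- a⁻¹ :* :- :1)) refl a a⁻¹ ⟩
        - a⁻¹ * - 1# * a * (- a⁻¹ + - 1# + - a⁻¹ * - 1#) ∎

  shadow-[0,0,s]→[0,1,s] : ∀ s → Shadow (ln (0# , 0# , s)) (ln (0# , 1# , s))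
  shadow-[0,0,s]→[0,1,s] s =
    vertical-shadow-criterion (0≢1 ∘ proj₁ ∘ vertical-common-neighbour) meets
    where
    meets : ∀ a → a ≢ 0# → CommonNeighbour (ln (0# , 0# , s)) (ln (a , 1# , s))
    meets a a≢0 with a⁻¹ , aa⁻¹≡1 ← inverse a a≢0 =
      pt (a⁻¹ , 0# , - s) , Equivalence.from inc-vertical (+-identityˡ 0# , -‿inverseˡ s) , e₂ , e₃
      where
      e₂ : 0# + 1# ≡ a⁻¹ * a
      e₂ = trans (+-identityˡ 1#) (trans (sym aa⁻¹≡1) (*-comm a a⁻¹))
      e₃ : - s + s ≡ a⁻¹ * 0# * a * (a⁻¹ + 0# + a⁻¹ * 0#)
      e₃ = solve 3 (λ s a a⁻¹ → :- s :+ s := a⁻¹ :* :0 :* a :* (a⁻¹ :+ :0 :+ a⁻¹ :* :0)) refl s a a⁻¹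

  shadowChain-[0,1,r]→[0,0,r-1] : ∀ r → ShadowChain (ln (0# , 1# , r)) (ln (0# , 0# , r - 1#))
  shadowChain-[0,1,r]→[0,0,r-1] r =
    shadow-[0,1,r]→[0,0,r-1] r , ln (0# , 1# , r - 1#) , shadow-[0,0,s]→[0,1,s] (r - 1#)

prime-power≢1 : ∀ {p k} → Prime p → k ≥ 1 → p ^ k ≢ 1
prime-power≢1 {p} {k} p-prime k≥1 pᵏ≡1 with ℕ.m^n≡1⇒n≡0∨m≡1 p k pᵏ≡1
... | inj₁ refl = ℕ.<⇒≱ k≥1 ℕ.z≤n
... | inj₂ refl = ¬prime[1] p-prime

≡1-mod-3⇒≥4 : ∀ {n} → n % 3 ≡ 1 → n ≢ 1 → 4 ℕ.≤ n
≡1-mod-3⇒≥4 {0}     ()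
≡1-mod-3⇒≥4 {1}     _ n≢1 = ⊥-elim (n≢1 refl)
≡1-mod-3⇒≥4 {2}     ()
≡1-mod-3⇒≥4 {3}     ()
≡1-mod-3⇒≥4 {suc (suc (suc (suc n)))} _ _ = s≤s (s≤s (s≤s (s≤s ℕ.z≤n)))

corollary4p4 : (K : FiniteField) →
    (∃[ p ] ∃[ k ] (Prime p × p % 2 ≡ 1 × k ≥ 1 × FiniteField.card K ≡ p ^ k)) →
    FiniteField.card K % 3 ≡ 1 →
    (a : GraphR.Automorphism K) →
    (r w : FiniteField.F K) →
    GraphR.apply K a (GraphR.ln (FiniteField.0# K , FiniteField.1# K , r))
      ≡ GraphR.ln (FiniteField.0# K , FiniteField.1# K , w) →
    GraphR.apply K a (GraphR.ln (FiniteField.0# K , FiniteField.0# K , FiniteField._-_ K r (FiniteField.1# K)))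
      ≡ GraphR.ln (FiniteField.0# K , FiniteField.0# K , FiniteField._-_ K w (FiniteField.1# K))
corollary4p4 K (p , k , p-prime , _ , k≥1 , q≡pᵏ) q≡1 a r w aL≡L′ =
  shadowChain-[0,1,w]⇒[0,0,w-1] 4≤q
    (subst (λ L → ShadowChain L (apply a (ln (0# , 0# , r - 1#)))) aL≡L′
      (shadowChain⇒ (shadowChain-[0,1,r]→[0,0,r-1] r)))
  where
  open FiniteField K
  open GraphR K using (apply; ln)
  open Geometry K
  open Preservation a
  4≤q : 4 ℕ.≤ card
  4≤q = ≡1-mod-3⇒≥4 q≡1 (prime-power≢1 p-prime k≥1 ∘ trans (sym q≡pᵏ))
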